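{- Let $G$ be a connected graph of order $n_1$ and let $n_2\ge 2$ be an integer. If $n_1>2n_2+1$, then $pd(G\odot K_{n_2})\ge n_2+2$.
   Context: $K_{n_2}$ is the complete graph of order $n_2$. For a connected graph $F$ and an ordered partition $\Pi=\{P_1,\dots,P_t\}$ of $V(F)$, $r(v|\Pi)=(d(v,P_1),\dots,d(v,P_t))$ where $d$ is shortest-path distance and $d(v,P_i)=\min_{u\in P_i}d(v,u)$; $\Pi$ is a resolving partition if $r(u|\Pi)\ne r(v|\Pi)$ for all distinct vertices $u,v$; $pd(F)$ is the minimum number of sets in a resolving partition. For graphs $G$ of order $n_1$ (vertices $v_1,\dots,v_{n_1}$) and $H$, the corona product $G\odot H$ is obtained from one copy of $G$ and $n_1$ copies $H_1,\dots,H_{n_1}$ of $H$ by joining $v_i$ to every vertex of $H_i$. -}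

module Defs where

open import Data.Nat using (ℕ; zero; suc; _+_; _*_; _⊓_; _≤_)
open import Data.Bool using (Bool; true; false; _∧_; _∨_; not; if_then_else_)
open import Data.Fin using (Fin; splitAt; remQuot)
open import Data.Fin.Properties using (_≟_)
open import Data.Sum using (_⊎_; inj₁; inj₂)
open import Data.Product using (_×_; _,_)
open import Data.List using (List; []; _∷_; allFin; foldr)
open import Data.Bool.ListAction using (any)
open import Relation.Nullary.Decidable using (⌊_⌋)
open import Relation.Binary.PropositionalEquality as P using (_≡_; _≢_; refl; cong; cong₂)
open import Relation.Nullary using (yes; no)
open import Data.Empty using (⊥-elim)
open import Data.Bool.Properties using (∧-zeroʳ)
import Data.Vec as Vec
open import Function.Definitions using (Surjective)

record Graph (n : ℕ) : Set where
  field
    adj    : Fin n → Fin n → Bool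
    sym    : ∀ u v → adj u v ≡ adj v u
    irrefl : ∀ v → adj v v ≡ false
open Graph public

data Walk {n : ℕ} (G : Graph n) : Fin n → Fin n → Set where
  [] : ∀ {v} → Walk G v v
  _∷_ : ∀ {u w v} → adj G u w ≡ true → Walk G w v → Walk G u v

Connected : ∀ {n} → Graph n → Set
Connected G = ∀ u v → Walk G u v

reach : ∀ {n} → Graph n → ℕ → Fin n → Fin n → Bool
reach G zero    u v = ⌊ u ≟ v ⌋
reach {n} G (suc k) u v =
  reach G k u v ∨ any (λ w → adj G u w ∧ reach G k w v) (allFin n)

search : ∀ {n} → Graph n → Fin n → Fin n → ℕ → ℕ → ℕ
search G u v k zero = k
search G u v k (suc fuel) =
  if reach G k u v then k else search G u v (suc k) fuel

-- Shortest-path distance d(u,v): the least k with a u–v walk of length k.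
-- (In a connected graph on n vertices this is ≤ n - 1, found by the search.)
dist : ∀ {n} → Graph n → Fin n → Fin n → ℕ
dist {n} G u v = search G u v 0 n

-- An ordered partition Π = {P_1,…,P_t} of V(F) with t parts is given by a
-- surjective class map  part : Fin n → Fin t  (P_i = part⁻¹(i), all nonempty).
-- d(v, P_i) = min_{u ∈ P_i} d(v,u).  (The initial value n of the minimum is
-- never attained for nonempty P_i in a connected graph, since d < n there.)
distToPart : ∀ {n t} → Graph n → (Fin n → Fin t) → Fin n → Fin t → ℕ
distToPart {n} G part v i =
  foldr (λ u m → if ⌊ part u ≟ i ⌋ then dist G v u ⊓ m else m) n (allFin n)

rep : ∀ {n t} → Graph n → (Fin n → Fin t) → Fin n → (Fin t → ℕ)
rep G part v i = distToPart G part v i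

IsPartition : ∀ {n t} → (Fin n → Fin t) → Set
IsPartition {n} {t} part = Surjective _≡_ _≡_ part

Resolving : ∀ {n t} → Graph n → (Fin n → Fin t) → Set
Resolving {n} {t} G part =
  ∀ (u v : Fin n) → u ≢ v → Vec.tabulate (rep G part u) ≢ Vec.tabulate (rep G part v)

PdAtLeast : ∀ {n} → Graph n → ℕ → Set
PdAtLeast {n} G m =
  ∀ (t : ℕ) (part : Fin n → Fin t) → IsPartition part → Resolving G part → m ≤ t

K : (n : ℕ) → Graph n
K n = record
  { adj    = λ x y → not ⌊ x ≟ y ⌋
  ; sym    = λ x y → cong not (≡ᵇ-sym x y)
  ; irrefl = λ x → cong not (≡ᵇ-refl x)
  }
  where
  ≡ᵇ-sym : ∀ (x y : Fin n) → ⌊ x ≟ y ⌋ ≡ ⌊ y ≟ x ⌋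
  ≡ᵇ-sym x y with x ≟ y | y ≟ x
  ... | yes _ | yes _ = refl
  ... | no _  | no _  = refl
  ... | yes p | no q  = ⊥-elim (q (P.sym p))
  ... | no p  | yes q = ⊥-elim (p (P.sym q))
  ≡ᵇ-refl : ∀ (x : Fin n) → ⌊ x ≟ x ⌋ ≡ true
  ≡ᵇ-refl x with x ≟ x
  ... | yes _ = refl
  ... | no p  = ⊥-elim (p refl)

-- Corona product G ⊙ H.  Vertex set Fin (n₁ + n₁ * n₂): the first n₁ vertices
-- are v_1..v_{n₁} of G; a vertex of the second block, decoded by remQuot as
-- (i , x), is vertex x of the copy H_i.
corAdj : ∀ {n₁ n₂} → Graph n₁ → Graph n₂ →
         Fin n₁ ⊎ (Fin n₁ × Fin n₂) → Fin n₁ ⊎ (Fin n₁ × Fin n₂) → Bool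
corAdj G H (inj₁ a) (inj₁ b) = adj G a b
corAdj G H (inj₁ a) (inj₂ (i , x)) = ⌊ a ≟ i ⌋
corAdj G H (inj₂ (i , x)) (inj₁ a) = ⌊ i ≟ a ⌋
corAdj G H (inj₂ (i , x)) (inj₂ (j , y)) = ⌊ i ≟ j ⌋ ∧ adj H x y

decode : ∀ n₁ n₂ → Fin (n₁ + n₁ * n₂) → Fin n₁ ⊎ (Fin n₁ × Fin n₂)
decode n₁ n₂ z with splitAt n₁ z
... | inj₁ a = inj₁ a
... | inj₂ w = inj₂ (remQuot n₂ w)

private
  eqᵇ-sym : ∀ {m} (x y : Fin m) → ⌊ x ≟ y ⌋ ≡ ⌊ y ≟ x ⌋
  eqᵇ-sym x y with x ≟ y | y ≟ x
  ... | yes _ | yes _ = refl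
  ... | no _  | no _  = refl
  ... | yes p | no q  = ⊥-elim (q (P.sym p))
  ... | no p  | yes q = ⊥-elim (p (P.sym q))

  corAdj-sym : ∀ {n₁ n₂} (G : Graph n₁) (H : Graph n₂) p q →
               corAdj G H p q ≡ corAdj G H q p
  corAdj-sym G H (inj₁ a) (inj₁ b) = sym G a b
  corAdj-sym G H (inj₁ a) (inj₂ (i , x)) = eqᵇ-sym a i
  corAdj-sym G H (inj₂ (i , x)) (inj₁ a) = eqᵇ-sym i a
  corAdj-sym G H (inj₂ (i , x)) (inj₂ (j , y)) =
    cong₂ _∧_ (eqᵇ-sym i j) (sym H x y)

  corAdj-irrefl : ∀ {n₁ n₂} (G : Graph n₁) (H : Graph n₂) p →
                  corAdj G H p p ≡ false
  corAdj-irrefl G H (inj₁ a) = irrefl G a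
  corAdj-irrefl G H (inj₂ (i , x)) rewrite irrefl H x = ∧-zeroʳ ⌊ i ≟ i ⌋

_⊙_ : ∀ {n₁ n₂} → Graph n₁ → Graph n₂ → Graph (n₁ + n₁ * n₂)
_⊙_ {n₁} {n₂} G H = record
  { adj    = λ u v → corAdj G H (decode n₁ n₂ u) (decode n₁ n₂ v)
  ; sym    = λ u v → corAdj-sym G H (decode n₁ n₂ u) (decode n₁ n₂ v)
  ; irrefl = λ u → corAdj-irrefl G H (decode n₁ n₂ u)
  }

module Submission where

-- Let Π be a resolving partition with t ≤ n₂ + 1 parts.  The n₂ leaves of a
-- copy H_i are pairwise twins, so they lie in n₂ distinct parts; and they
-- cannot meet every part, for then the hub v_i would share its representation
-- with a leaf.  Hence t = n₂ + 1 and copy i misses exactly one part, P_{m(i)}.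
-- The representation of v_i is then 0 at its own part, c(i) = d(v_i, P_{m(i)})
-- at m(i) and 1 elsewhere, while each leaf of H_i has c(i) + 1 at m(i).
-- Comparing such "profiles" shows c(i) ≤ 2 and that i ↦ m(i) (collapsing all
-- hubs with c(i) = 0 to one extra value) is injective, so n₁ ≤ t + 1; with
-- n₁ ≥ 2n₂ + 2 this forces t ≥ 2n₂ + 1 ≥ n₂ + 2 after all.

open import Defs hiding (sym)
open import Data.Nat using (ℕ; zero; suc; _+_; _*_; _⊓_; _≤_; _<_; _≤′_; ≤′-refl; ≤′-step; z≤n; s≤s)
open import Data.Nat.Properties
  using (≤-trans; ≤-antisym; ≤-reflexive; ≤-pred; <⇒≤; ≮⇒≥; ≰⇒>; _≤?_;
         m≤n⇒m<n∨m≡n; m<n⇒m<1+n; n≤1+n; m≤n+m; n≤0⇒n≡0; 0≢1+n; +-suc;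
         +-identityʳ; m⊓n≤m; m⊓n≤n; ⊓-sel; ≤⇒≤′; +-monoˡ-≤; +-monoʳ-≤; +-assoc;
         +-comm; <-irrefl; ≤⇒≯; module ≤-Reasoning)
open import Data.Bool using (Bool; true; false; T; _∧_; not; if_then_else_)
open import Data.Bool.Properties using (T-∨; T-∧)
open import Data.Bool.ListAction using (any)
open import Data.Fin using (Fin; toℕ; fromℕ; fromℕ<; inject₁; _↑ˡ_; _↑ʳ_; splitAt; combine)
open import Data.Fin.Properties
  using (_≟_; toℕ-injective; toℕ<n; any?; all?; ¬∀⟶∃¬; injective⇒≤;
         fromℕ≢inject₁; inject₁-injective;
         splitAt-↑ˡ; splitAt-↑ʳ; remQuot-combine; combine-remQuot; join-splitAt)
open import Data.List using (allFin; foldr; tabulate)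
open import Data.List.Relation.Unary.Any as Any using ()
open import Data.List.Relation.Unary.Any.Properties using (any⁺; any⁻)
open import Data.List.Membership.Propositional.Properties using (∈-allFin)
open import Data.Vec.Properties using (tabulate-cong)
open import Data.Sum using (_⊎_; inj₁; inj₂)
open import Data.Product using (_×_; _,_; ∃; proj₁; proj₂)
open import Data.Empty using (⊥-elim)
open import Function using (_∘_; id; flip)
open import Function.Bundles using (Equivalence)
open import Relation.Nullary using (¬_; Dec; yes; no)
open import Relation.Nullary.Decidable using (⌊_⌋; toWitness; fromWitness; fromWitnessFalse; T?)
open import Relation.Binary.PropositionalEquality
  using (_≡_; _≢_; refl; sym; trans; cong; subst)

open Equivalence using (to; from)

any-allFin⁻ : ∀ {n} (p : Fin n → Bool) → T (any p (allFin n)) → ∃ λ w → T (p w)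
any-allFin⁻ p h = Any.satisfied (any⁻ p (allFin _) h)

any-allFin⁺ : ∀ {n} (p : Fin n → Bool) w → T (p w) → T (any p (allFin n))
any-allFin⁺ p w h = any⁺ p (Any.map (λ { refl → h }) (∈-allFin w))

-- Walks of bounded length, read off the boolean `reach` of Defs.  Adjacency
-- and reachability are wrapped in records so that their indices can be
-- inferred by unification.
module Reachability {N : ℕ} (F : Graph N) where

  record Adj (u w : Fin N) : Set where
    constructor edge
    field is-edge : T (adj F u w)

  record Reach (k : ℕ) (u v : Fin N) : Set where
    constructor reached
    field is-reached : T (reach F k u v)

  reach-suc : ∀ {k u v} → Reach k u v → Reach (suc k) u v
  reach-suc {k} {u} {v} (reached h) = reached (from (T-∨ {reach F k u v}) (inj₁ h))

  reach-mono : ∀ {j k u v} → j ≤ k → Reach j u v → Reach k u v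
  reach-mono j≤k h = go (≤⇒≤′ j≤k)
    where
    go : ∀ {k} → _ ≤′ k → Reach k _ _
    go ≤′-refl       = h
    go (≤′-step j≤k) = reach-suc (go j≤k)

  reach-refl : ∀ k u → Reach k u u
  reach-refl k u = reach-mono z≤n (reached (fromWitness refl))

  reach-zero : ∀ {u v} → Reach 0 u v → u ≡ v
  reach-zero (reached h) = toWitness h

  reach-step : ∀ {k u w v} → Adj u w → Reach k w v → Reach (suc k) u v
  reach-step {k} {u} {w} {v} (edge a) (reached r) =
    reached (from (T-∨ {reach F k u v})
      (inj₂ (any-allFin⁺ (λ z → adj F u z ∧ reach F k z v) w
               (from (T-∧ {adj F u w}) (a , r)))))

  reach-unfold : ∀ {k u v} → Reach (suc k) u v →
                 u ≡ v ⊎ ∃ λ w → Adj u w × Reach k w v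
  reach-unfold {k} {u} {v} (reached h) with to (T-∨ {reach F k u v}) h
  ... | inj₂ e with any-allFin⁻ (λ z → adj F u z ∧ reach F k z v) e
  ...   | w , aw with to (T-∧ {adj F u w}) aw
  ...     | a , r = inj₂ (w , edge a , reached r)
  reach-unfold {zero}  _ | inj₁ e = inj₁ (reach-zero (reached e))
  reach-unfold {suc k} _ | inj₁ e with reach-unfold {k} (reached e)
  ... | inj₁ u≡v         = inj₁ u≡v
  ... | inj₂ (w , a , r) = inj₂ (w , a , reach-suc r)

  reach-append : ∀ {j k u w v} → Reach j u w → Reach k w v → Reach (j + k) u v
  reach-append {zero}      h₁ h₂ rewrite reach-zero h₁ = h₂
  reach-append {suc j} {k} h₁ h₂ with reach-unfold h₁
  ... | inj₁ refl         = reach-mono (m≤n+m k (suc j)) h₂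
  ... | inj₂ (_ , a , r)  = reach-step a (reach-append r h₂)

  NoShorter : Fin N → Fin N → ℕ → Set
  NoShorter u v k = ∀ j → j < k → ¬ Reach j u v

  no-shorter-≤ : ∀ {u v a b} → Reach a u v → NoShorter u v b → b ≤ a
  no-shorter-≤ {a = a} h nos = ≮⇒≥ (λ a<b → nos a a<b h)

  shortest : ∀ {u v} k → Reach k u v → ∃ λ m → Reach m u v × NoShorter u v m
  shortest zero h = 0 , h , λ _ ()
  shortest {u} {v} (suc k) h with T? (reach F k u v)
  ... | yes h′ = shortest k (reached h′)
  ... | no ¬h  = suc k , h , λ j j<1+k hj →
                   ¬h (Reach.is-reached (reach-mono (≤-pred j<1+k) hj))

  layer : ∀ {v} m u → Reach m u v → NoShorter u v m → ∀ j → j ≤ m →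
          ∃ λ w → Reach j w v × NoShorter w v j
  layer m u h nos j j≤m with m≤n⇒m<n∨m≡n j≤m
  ... | inj₂ refl = u , h , nos
  layer {v} (suc m) u h nos j _ | inj₁ j<1+m with reach-unfold h
  ... | inj₁ refl = ⊥-elim (nos 0 (s≤s z≤n) (reach-refl 0 u))
  ... | inj₂ (w , a , r) = layer m w r nos′ j (≤-pred j<1+m)
    where
    nos′ : NoShorter w v m
    nos′ i i<m hi = nos (suc i) (s≤s i<m) (reach-step a hi)

  -- Pigeonhole: the m + 1 layers of a shortest walk are distinct vertices,
  -- so a shortest walk has length < N.
  shortest-< : ∀ {u v} m → Reach m u v → NoShorter u v m → m < N
  shortest-< {u} {v} m h nos = injective⇒≤ layers-injective
    where
    at : (i : Fin (suc m)) → ∃ λ w → Reach (toℕ i) w v × NoShorter w v (toℕ i)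
    at i = layer m u h nos (toℕ i) (≤-pred (toℕ<n i))
    layers-injective : ∀ {i i′} → proj₁ (at i) ≡ proj₁ (at i′) → i ≡ i′
    layers-injective {i} {i′} e with at i | at i′
    ... | w , r , nos₁ | w′ , r′ , nos₂ =
      toℕ-injective (≤-antisym (no-shorter-≤ (subst (λ z → Reach _ z v) (sym e) r′) nos₁)
                                (no-shorter-≤ (subst (λ z → Reach _ z v) e r) nos₂))

  reach-within-order : (∀ u v → ∃ λ k → Reach k u v) → ∀ u v → Reach N u v
  reach-within-order conn u v with conn u v
  ... | k , h with shortest k h
  ...   | m , h′ , nos = reach-mono (<⇒≤ (shortest-< m h′ nos)) h′

-- Shortest-path distance `dist` in a graph where every pair is joined within
-- N steps (by `reach-within-order`, any connected graph on N vertices).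
module Distance {N : ℕ} (F : Graph N)
                (reachable : ∀ u v → Reachability.Reach F N u v) where
  open Reachability F

  d : Fin N → Fin N → ℕ
  d = dist F

  search-correct : ∀ {u v} k fuel → NoShorter u v k → Reach (k + fuel) u v →
                   Reach (search F u v k fuel) u v × NoShorter u v (search F u v k fuel)
  search-correct {u} {v} k zero nos h rewrite +-identityʳ k = h , nos
  search-correct {u} {v} k (suc fuel) nos h with reach F k u v in eq
  ... | true  = reached (subst T (sym eq) _) , nos
  ... | false = search-correct (suc k) fuel nos′ (subst (λ n → Reach n u v) (+-suc k fuel) h)
    where
    nos′ : NoShorter u v (suc k)
    nos′ j (s≤s j≤k) hj with m≤n⇒m<n∨m≡n j≤k
    ... | inj₁ j<k  = nos j j<k hj
    ... | inj₂ refl = subst T eq (Reach.is-reached hj)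

  dist-spec : ∀ u v → Reach (d u v) u v × NoShorter u v (d u v)
  dist-spec u v = search-correct 0 N (λ _ ()) (reachable u v)

  dist-least : ∀ {j u v} → Reach j u v → d u v ≤ j
  dist-least {u = u} {v} h = ≮⇒≥ (λ j<d → proj₂ (dist-spec u v) _ j<d h)

  dist-≤-order : ∀ u v → d u v ≤ N
  dist-≤-order u v = dist-least (reachable u v)

  dist-self : ∀ u → d u u ≡ 0
  dist-self u = n≤0⇒n≡0 (dist-least (reach-refl 0 u))

  dist-zero : ∀ {u v} → d u v ≡ 0 → u ≡ v
  dist-zero {u} {v} e = reach-zero (subst (λ n → Reach n u v) e (proj₁ (dist-spec u v)))

  dist-step : ∀ {u w v} → Adj u w → d u v ≤ suc (d w v)
  dist-step {w = w} {v} a = dist-least (reach-step a (proj₁ (dist-spec w v)))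

  dist-edge : ∀ {u w} → Adj u w → d u w ≤ 1
  dist-edge {u} {w} a = subst (λ n → d u w ≤ suc n) (dist-self w) (dist-step a)

  dist-pred : ∀ {u v k} → d u v ≡ suc k → ∃ λ w → Adj u w × d w v ≡ k
  dist-pred {u} {v} {k} e with reach-unfold (subst (λ n → Reach n u v) e (proj₁ (dist-spec u v)))
  ... | inj₁ refl = ⊥-elim (0≢1+n (trans (sym (dist-self u)) e))
  ... | inj₂ (w , a , r) =
        w , a , ≤-antisym (dist-least r) (≤-pred (subst (_≤ suc (d w v)) e (dist-step a)))

  Dominated : Fin N → Fin N → Set
  Dominated a b = ∀ z → Adj a z → z ≡ b ⊎ Adj b z

  dist-dominated : ∀ {a b w} → Dominated a b → w ≢ a →
                   d b w ≤ d a w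
  dist-dominated {a} {b} {w} nbrs w≢a with d a w in eq
  ... | zero  = ⊥-elim (w≢a (sym (dist-zero eq)))
  ... | suc k with dist-pred eq
  ...   | z , az , dz with nbrs z az
  ...     | inj₁ refl = ≤-trans (≤-reflexive dz) (n≤1+n k)
  ...     | inj₂ bz   = subst (λ n → d b w ≤ suc n) dz (dist-step bz)

  module PartDistance {t : ℕ} (part : Fin N → Fin t) (surj : IsPartition part) where

    dP : Fin N → Fin t → ℕ
    dP = rep F part

    private
      minStep : Fin N → Fin t → Fin N → ℕ → ℕ
      minStep v j u m = if ⌊ part u ≟ j ⌋ then d v u ⊓ m else m

      fold-≤ : ∀ v j {m} (h : Fin m → Fin N) (i : Fin m) → part (h i) ≡ j →
               foldr (minStep v j) N (tabulate h) ≤ d v (h i)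
      fold-≤ v j h Fin.zero e with part (h Fin.zero) ≟ j
      ... | yes _ = m⊓n≤m _ _
      ... | no ne = ⊥-elim (ne e)
      fold-≤ v j h (Fin.suc i) e with ⌊ part (h Fin.zero) ≟ j ⌋
      ... | true  = ≤-trans (m⊓n≤n _ _) (fold-≤ v j (h ∘ Fin.suc) i e)
      ... | false = fold-≤ v j (h ∘ Fin.suc) i e

      fold-attained : ∀ v j {m} (h : Fin m → Fin N) →
        foldr (minStep v j) N (tabulate h) ≡ N ⊎
        ∃ λ i → part (h i) ≡ j × foldr (minStep v j) N (tabulate h) ≡ d v (h i)
      fold-attained v j {zero} h = inj₁ refl
      fold-attained v j {suc m} h with part (h Fin.zero) ≟ j
      ... | no _ with fold-attained v j (h ∘ Fin.suc)
      ...   | inj₁ e           = inj₁ e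
      ...   | inj₂ (i , p , e) = inj₂ (Fin.suc i , p , e)
      fold-attained v j {suc m} h | yes p
        with ⊓-sel (d v (h Fin.zero)) (foldr (minStep v j) N (tabulate (h ∘ Fin.suc)))
      ... | inj₁ e = inj₂ (Fin.zero , p , e)
      ... | inj₂ e with fold-attained v j (h ∘ Fin.suc)
      ...   | inj₁ e′           = inj₁ (trans e e′)
      ...   | inj₂ (i , p′ , e′) = inj₂ (Fin.suc i , p′ , trans e e′)

    dP-≤ : ∀ {v j u} → part u ≡ j → dP v j ≤ d v u
    dP-≤ {v} {j} {u} = fold-≤ v j id u

    dP-attained : ∀ v j → ∃ λ u → part u ≡ j × dP v j ≡ d v u
    dP-attained v j with fold-attained v j id
    ... | inj₂ attained = attained
    ... | inj₁ e with surj j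
    ...   | u , pu = u , pu refl ,
                     ≤-antisym (dP-≤ (pu refl)) (≤-trans (dist-≤-order v u) (≤-reflexive (sym e)))

    dP-own : ∀ {v j} → part v ≡ j → dP v j ≡ 0
    dP-own {v} e = n≤0⇒n≡0 (≤-trans (dP-≤ e) (≤-reflexive (dist-self v)))

    dP-neighbour : ∀ {v j u} → part v ≢ j → Adj v u → part u ≡ j → dP v j ≡ 1
    dP-neighbour {v} {j} ne a pu with dP-attained v j
    ... | w , pw , e = ≤-antisym (≤-trans (dP-≤ pu) (dist-edge a)) positive
      where
      positive : 1 ≤ dP v j
      positive with d v w in dw
      ... | zero  = ⊥-elim (ne (trans (cong part (dist-zero dw)) pw))
      ... | suc _ = subst (1 ≤_) (sym e) (s≤s z≤n)

    resolved : Resolving F part → ∀ {u v} → (∀ j → dP u j ≡ dP v j) → u ≡ v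
    resolved res {u} {v} same with u ≟ v
    ... | yes u≡v = u≡v
    ... | no u≢v  = ⊥-elim (res u v u≢v (tabulate-cong same))

    dP-step : ∀ {v w j} → Adj v w → dP v j ≤ suc (dP w j)
    dP-step {v} {w} {j} a with dP-attained w j
    ... | u , pu , e = ≤-trans (dP-≤ pu) (subst (λ n → d v u ≤ suc n) (sym e) (dist-step a))

    dP-dominated : ∀ {a b j} → Dominated a b → part a ≢ j → dP b j ≤ dP a j
    dP-dominated {a} {b} {j} dom ne with dP-attained a j
    ... | u , pu , e = ≤-trans (dP-≤ pu)
                         (≤-trans (dist-dominated dom (λ u≡a → ne (trans (cong part (sym u≡a)) pu)))
                                  (≤-reflexive (sym e)))

    -- Twins (each dominated by the other) in a common part have the same
    -- representation; so a resolving partition puts distinct twins apart.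
    twins-separated : Resolving F part → ∀ {a b} → a ≢ b →
                      Dominated a b → Dominated b a → part a ≢ part b
    twins-separated res {a} {b} a≢b ab ba same-part = a≢b (resolved res same-rep)
      where
      same-rep : ∀ j → dP a j ≡ dP b j
      same-rep j with part a ≟ j
      ... | yes e = trans (dP-own e) (sym (dP-own (trans (sym same-part) e)))
      ... | no ne = ≤-antisym (dP-dominated ba (λ e → ne (trans same-part e)))
                              (dP-dominated ab ne)

injective-avoiding-two : ∀ {n t} (f : Fin n → Fin t) → (∀ {x y} → f x ≡ f y → x ≡ y) →
  ∀ {p q} → p ≢ q → (∀ x → f x ≢ p) → (∀ x → f x ≢ q) → suc (suc n) ≤ t
injective-avoiding-two {n} {t} f f-inj {p} {q} p≢q avoids-p avoids-q =
  injective⇒≤ {f = extended} extended-injective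
  where
  extended : Fin (suc (suc n)) → Fin t
  extended Fin.zero                = p
  extended (Fin.suc Fin.zero)      = q
  extended (Fin.suc (Fin.suc x))   = f x

  extended-injective : ∀ {x y} → extended x ≡ extended y → x ≡ y
  extended-injective {Fin.zero}              {Fin.zero}              _ = refl
  extended-injective {Fin.zero}              {Fin.suc Fin.zero}      e = ⊥-elim (p≢q e)
  extended-injective {Fin.zero}              {Fin.suc (Fin.suc y)}   e = ⊥-elim (avoids-p y (sym e))
  extended-injective {Fin.suc Fin.zero}      {Fin.zero}              e = ⊥-elim (p≢q (sym e))
  extended-injective {Fin.suc Fin.zero}      {Fin.suc Fin.zero}      _ = refl
  extended-injective {Fin.suc Fin.zero}      {Fin.suc (Fin.suc y)}   e = ⊥-elim (avoids-q y (sym e))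
  extended-injective {Fin.suc (Fin.suc x)}   {Fin.zero}              e = ⊥-elim (avoids-p x e)
  extended-injective {Fin.suc (Fin.suc x)}   {Fin.suc Fin.zero}      e = ⊥-elim (avoids-q x e)
  extended-injective {Fin.suc (Fin.suc x)}   {Fin.suc (Fin.suc y)}   e = cong (Fin.suc ∘ Fin.suc) (f-inj e)

module Corona {n₁ : ℕ} (G : Graph n₁) (n₂ : ℕ) where

  N : ℕ
  N = n₁ + n₁ * n₂

  F : Graph N
  F = G ⊙ K n₂

  open Reachability F public

  hub : Fin n₁ → Fin N
  hub i = i ↑ˡ (n₁ * n₂)

  leaf : Fin n₁ → Fin n₂ → Fin N
  leaf i x = n₁ ↑ʳ combine i x

  decode-hub : ∀ i → decode n₁ n₂ (hub i) ≡ inj₁ i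
  decode-hub i rewrite splitAt-↑ˡ n₁ i (n₁ * n₂) = refl

  decode-leaf : ∀ i x → decode n₁ n₂ (leaf i x) ≡ inj₂ (i , x)
  decode-leaf i x rewrite splitAt-↑ʳ n₁ (n₁ * n₂) (combine i x)
                        | remQuot-combine {n₁} {n₂} i x = refl

  data Vertex : Fin N → Set where
    is-hub  : ∀ i → Vertex (hub i)
    is-leaf : ∀ i x → Vertex (leaf i x)

  vertex : ∀ z → Vertex z
  vertex z with splitAt n₁ z | join-splitAt n₁ (n₁ * n₂) z
  ... | inj₁ i | e = subst Vertex e (is-hub i)
  ... | inj₂ w | e = subst Vertex e (subst (λ w → Vertex (n₁ ↑ʳ w))
                                            (combine-remQuot {n₁} n₂ w) (is-leaf _ _))

  hub≢leaf : ∀ {i k x} → hub i ≢ leaf k x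
  hub≢leaf {i} {k} {x} e with trans (sym (decode-hub i)) (trans (cong (decode n₁ n₂) e) (decode-leaf k x))
  ... | ()

  hub-injective : ∀ {i k} → hub i ≡ hub k → i ≡ k
  hub-injective {i} {k} e with trans (sym (decode-hub i)) (trans (cong (decode n₁ n₂) e) (decode-hub k))
  ... | refl = refl

  leaf-injective : ∀ {i k x y} → leaf i x ≡ leaf k y → i ≡ k × x ≡ y
  leaf-injective {i} {k} {x} {y} e
    with trans (sym (decode-leaf i x)) (trans (cong (decode n₁ n₂) e) (decode-leaf k y))
  ... | refl = refl , refl

  private
    adj-hub-hub : ∀ i k → adj F (hub i) (hub k) ≡ adj G i k
    adj-hub-hub i k rewrite decode-hub i | decode-hub k = refl

    adj-hub-leaf : ∀ i k x → adj F (hub i) (leaf k x) ≡ ⌊ i ≟ k ⌋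
    adj-hub-leaf i k x rewrite decode-hub i | decode-leaf k x = refl

    adj-leaf-hub : ∀ k x i → adj F (leaf k x) (hub i) ≡ ⌊ k ≟ i ⌋
    adj-leaf-hub k x i rewrite decode-hub i | decode-leaf k x = refl

    adj-leaf-leaf : ∀ i x k y → adj F (leaf i x) (leaf k y) ≡ ⌊ i ≟ k ⌋ ∧ not ⌊ x ≟ y ⌋
    adj-leaf-leaf i x k y rewrite decode-leaf i x | decode-leaf k y = refl

  hub-hub : ∀ {i k} → adj G i k ≡ true → Adj (hub i) (hub k)
  hub-hub {i} {k} e = edge (subst T (sym (trans (adj-hub-hub i k) e)) _)

  hub-leaf : ∀ i x → Adj (hub i) (leaf i x)
  hub-leaf i x = edge (subst T (sym (adj-hub-leaf i i x)) (fromWitness refl))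

  leaf-hub : ∀ i x → Adj (leaf i x) (hub i)
  leaf-hub i x = edge (subst T (sym (adj-leaf-hub i x i)) (fromWitness refl))

  leaf-leaf : ∀ i {x y} → x ≢ y → Adj (leaf i x) (leaf i y)
  leaf-leaf i {x} {y} x≢y =
    edge (subst T (sym (adj-leaf-leaf i x i y)) (from (T-∧ {⌊ i ≟ i ⌋}) (fromWitness refl , fromWitnessFalse {a? = x ≟ y} x≢y)))

  leaf-hub⁻ : ∀ {i x k} → Adj (leaf i x) (hub k) → i ≡ k
  leaf-hub⁻ {i} {x} {k} (edge a) = toWitness (subst T (adj-leaf-hub i x k) a)

  leaf-leaf⁻ : ∀ {i x k y} → Adj (leaf i x) (leaf k y) → i ≡ k
  leaf-leaf⁻ {i} {x} {k} {y} (edge a) =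
    toWitness (proj₁ (to (T-∧ {⌊ i ≟ k ⌋}) (subst T (adj-leaf-leaf i x k y) a)))

  hub-leaf⁻ : ∀ {i k x} → Adj (hub i) (leaf k x) → i ≡ k
  hub-leaf⁻ {i} {k} {x} (edge a) = toWitness (subst T (adj-hub-leaf i k x) a)

  -- G ⊙ K_{n₂} is connected when G is: go to a hub, along G, then out.
  walk-in-corona : ∀ {i k} → Walk G i k → ∃ λ m → Reach m (hub i) (hub k)
  walk-in-corona {i} []     = 0 , reach-refl 0 (hub i)
  walk-in-corona (e ∷ walk) with walk-in-corona walk
  ... | m , r = suc m , reach-step (hub-hub e) r

  to-hub : ∀ u → ∃ λ i → Reach 1 u (hub i)
  to-hub u with vertex u
  ... | is-hub i    = i , reach-refl 1 (hub i)
  ... | is-leaf i x = i , reach-step (leaf-hub i x) (reach-refl 0 (hub i))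

  from-hub : ∀ v → ∃ λ i → Reach 1 (hub i) v
  from-hub v with vertex v
  ... | is-hub i    = i , reach-refl 1 (hub i)
  ... | is-leaf i x = i , reach-step (hub-leaf i x) (reach-refl 0 (leaf i x))

  corona-reachable : Connected G → ∀ u v → Reach N u v
  corona-reachable connected = reach-within-order joined
    where
    joined : ∀ u v → ∃ λ m → Reach m u v
    joined u v with to-hub u | from-hub v
    ... | i , r₁ | k , r₃ with walk-in-corona (connected i k)
    ...   | m , r₂ = 1 + (m + 1) , reach-append r₁ (reach-append r₂ r₃)

module FewParts {n₁ : ℕ} (G : Graph n₁) (connected : Connected G) {n₂ : ℕ} (x₀ : Fin n₂)
                {t : ℕ} (part : Fin (n₁ + n₁ * n₂) → Fin t) (surj : IsPartition part)
                (res : Resolving (G ⊙ K n₂) part) (few : t ≤ suc n₂) where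
  open Corona G n₂
  open Distance F (corona-reachable connected)
  open PartDistance part surj

  leaf-dominated : ∀ i x y → Dominated (leaf i x) (leaf i y)
  leaf-dominated i x y z a with vertex z
  ... | is-hub k = inj₂ (subst (λ k → Adj (leaf i y) (hub k)) (leaf-hub⁻ a) (leaf-hub i y))
  ... | is-leaf k x′ with leaf-leaf⁻ a
  ...   | refl with x′ ≟ y
  ...     | yes refl = inj₁ refl
  ...     | no x′≢y  = inj₂ (leaf-leaf i (λ e → x′≢y (sym e)))

  leaf-parts-injective : ∀ i {x y} → part (leaf i x) ≡ part (leaf i y) → x ≡ y
  leaf-parts-injective i {x} {y} same-part with x ≟ y
  ... | yes x≡y = x≡y
  ... | no x≢y  = ⊥-elim (twins-separated res (x≢y ∘ proj₂ ∘ leaf-injective)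
                           (leaf-dominated i x y) (leaf-dominated i y x) same-part)

  Meets : Fin n₁ → Fin t → Set
  Meets i j = ∃ λ x → part (leaf i x) ≡ j

  meets? : ∀ i j → Dec (Meets i j)
  meets? i j = any? (λ x → part (leaf i x) ≟ j)

  -- If H_i met every part, v_i and the leaf sharing its part would have the
  -- same representation: 0 at that part and 1 everywhere else.
  copy-misses-a-part : ∀ i → ¬ (∀ j → Meets i j)
  copy-misses-a-part i meets-all with meets-all (part (hub i))
  ... | x , px = hub≢leaf (resolved res same-rep)
    where
    same-rep : ∀ j → dP (hub i) j ≡ dP (leaf i x) j
    same-rep j with part (hub i) ≟ j | meets-all j
    ... | yes e   | _      = trans (dP-own e) (sym (dP-own (trans px e)))
    ... | no ne   | y , py = trans (dP-neighbour ne (hub-leaf i y) py)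
                                   (sym (dP-neighbour (ne ∘ trans (sym px)) (leaf-leaf i x≢y) py))
      where
      x≢y : x ≢ y
      x≢y refl = ne (trans (sym px) py)

  -- With t ≤ n₂ + 1, the n₂ distinct parts of H_i leave only one part out.
  missed-unique : ∀ i {p q} → ¬ Meets i p → ¬ Meets i q → p ≡ q
  missed-unique i {p} {q} ¬p ¬q with p ≟ q
  ... | yes p≡q = p≡q
  ... | no p≢q  = ⊥-elim (<-irrefl refl (≤-trans
          (injective-avoiding-two (λ x → part (leaf i x)) (leaf-parts-injective i) p≢q
                                  (λ x e → ¬p (x , e)) (λ x e → ¬q (x , e)))
          few))

  missed-exists : ∀ i → ∃ λ m → ¬ Meets i m
  missed-exists i with all? (meets? i)
  ... | yes meets-all = ⊥-elim (copy-misses-a-part i meets-all)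
  ... | no ¬meets-all = ¬∀⟶∃¬ t (Meets i) (meets? i) ¬meets-all

  missed : Fin n₁ → Fin t
  missed i = proj₁ (missed-exists i)

  misses : ∀ i → ¬ Meets i (missed i)
  misses i = proj₂ (missed-exists i)

  meets-others : ∀ i j → j ≢ missed i → Meets i j
  meets-others i j j≢m with meets? i j
  ... | yes meets = meets
  ... | no ¬meets = ⊥-elim (j≢m (missed-unique i ¬meets (misses i)))

  gap : Fin n₁ → ℕ
  gap i = dP (hub i) (missed i)

  -- Leaving H_i means passing through v_i.
  leaf-detour : ∀ i {w} → (∀ y → w ≢ leaf i y) → ∀ k x → d (leaf i x) w ≡ k → d (hub i) w < k
  leaf-detour i outside zero x e = ⊥-elim (outside x (sym (dist-zero e)))
  leaf-detour i outside (suc k) x e with dist-pred e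
  ... | z , a , dz with vertex z
  ...   | is-hub k′ with leaf-hub⁻ a
  ...     | refl = s≤s (≤-reflexive dz)
  leaf-detour i outside (suc k) x e | z , a , dz | is-leaf k′ x′ with leaf-leaf⁻ a
  ... | refl = m<n⇒m<1+n (leaf-detour i outside k x′ dz)

  outside-copy : ∀ i {u} → part u ≡ missed i → ∀ y → u ≢ leaf i y
  outside-copy i pu y refl = misses i (y , pu)

  leaf-gap : ∀ i x → dP (leaf i x) (missed i) ≡ suc (gap i)
  leaf-gap i x with dP-attained (leaf i x) (missed i)
  ... | u , pu , e = ≤-antisym (dP-step (leaf-hub i x))
                       (subst (suc (gap i) ≤_) (sym e)
                          (≤-trans (s≤s (dP-≤ pu)) (leaf-detour i (outside-copy i pu) _ x refl)))

  Profile : Fin N → Fin t → Fin t → ℕ → Set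
  Profile u p q a = dP u p ≡ 0 × dP u q ≡ a × (∀ j → j ≢ p → j ≢ q → dP u j ≡ 1)

  profile-unique : ∀ {u w p q a} → Profile u p q a → Profile w p q a → u ≡ w
  profile-unique {u} {w} {p} {q} (u-p , u-q , u-rest) (w-p , w-q , w-rest) = resolved res same-rep
    where
    same-rep : ∀ j → dP u j ≡ dP w j
    same-rep j with j ≟ p | j ≟ q
    ... | yes refl | _        = trans u-p (sym w-p)
    ... | no _     | yes refl = trans u-q (sym w-q)
    ... | no j≢p   | no j≢q   = trans (u-rest j j≢p j≢q) (sym (w-rest j j≢p j≢q))

  reprofile : ∀ {u p q a p′ q′ a′} → Profile u p q a → p ≡ p′ → q ≡ q′ → a ≡ a′ →
              Profile u p′ q′ a′
  reprofile profile refl refl refl = profile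

  leaf-profile : ∀ i x → Profile (leaf i x) (part (leaf i x)) (missed i) (suc (gap i))
  leaf-profile i x = dP-own refl , leaf-gap i x , rest
    where
    rest : ∀ j → j ≢ part (leaf i x) → j ≢ missed i → dP (leaf i x) j ≡ 1
    rest j j≢p j≢m with meets-others i j j≢m
    ... | y , py = dP-neighbour (j≢p ∘ sym) (leaf-leaf i x≢y) py
      where
      x≢y : x ≢ y
      x≢y refl = j≢p (sym py)

  hub-profile : ∀ i → Profile (hub i) (part (hub i)) (missed i) (gap i)
  hub-profile i = dP-own refl , refl , rest
    where
    rest : ∀ j → j ≢ part (hub i) → j ≢ missed i → dP (hub i) j ≡ 1
    rest j j≢p j≢m with meets-others i j j≢m
    ... | y , py = dP-neighbour (j≢p ∘ sym) (hub-leaf i y) py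

  hub-gap-zero : ∀ i → gap i ≡ 0 → part (hub i) ≡ missed i
  hub-gap-zero i gap≡0 with dP-attained (hub i) (missed i)
  ... | u , pu , e = trans (cong part (dist-zero (trans (sym e) gap≡0))) pu

  gap-zero-unique : ∀ i k → gap i ≡ 0 → gap k ≡ 0 → i ≡ k
  gap-zero-unique i k gi gk with missed i ≟ missed k
  ... | yes same = hub-injective (profile-unique
          (reprofile (hub-profile i) (trans (hub-gap-zero i gi) same) same gi)
          (reprofile (hub-profile k) (hub-gap-zero k gk) refl gk))
  ... | no differ with meets-others i (missed k) (differ ∘ sym) | meets-others k (missed i) differ
  ...   | x , px | y , py = ⊥-elim (hub≢leaf (profile-unique hub-k leaf-i))
    where
    pk : part (hub k) ≡ missed k
    pk = hub-gap-zero k gk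
    leaf-i : Profile (leaf i x) (missed k) (missed i) 1
    leaf-i = reprofile (leaf-profile i x) px refl (cong suc gi)
    hub-k : Profile (hub k) (missed k) (missed i) 1
    hub-k = dP-own pk , dP-neighbour (differ ∘ sym ∘ trans (sym pk)) (hub-leaf k y) py ,
            λ j j≢mk j≢mi → proj₂ (proj₂ (hub-profile k)) j (j≢mk ∘ flip trans pk) j≢mk

  same-gap-unique : ∀ i k → missed i ≡ missed k → gap i ≡ gap k → i ≡ k
  same-gap-unique i k same-m same-c
    with meets-others k (part (leaf i x₀)) (λ e → misses i (x₀ , trans e (sym same-m)))
  ... | y , py = proj₁ (leaf-injective (profile-unique (leaf-profile i x₀)
                   (reprofile (leaf-profile k y) py (sym same-m) (cong suc (sym same-c)))))

  no-gap-step : ∀ i k → missed i ≡ missed k → gap i ≢ suc (gap k)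
  no-gap-step i k same-m step with meets-others k (part (hub i)) part≢m
    where
    part≢m : part (hub i) ≢ missed k
    part≢m e with trans (sym step) (dP-own (trans e (sym same-m)))
    ... | ()
  ... | y , py = hub≢leaf (profile-unique (hub-profile i)
                   (reprofile (leaf-profile k y) py (sym same-m) (sym step)))

  -- c(i) ≤ 2: follow a shortest path from v_i to P_{m(i)}.  Its second vertex
  -- is not a leaf (paths leave H_i through v_i); if it is a hub v_k, then
  -- either H_k meets P_{m(i)} and c(i) ≤ 2, or m(k) = m(i) and c(i) = c(k) + 1.
  gap-≢-3+ : ∀ i r → gap i ≢ 3 + r
  gap-≢-3+ i r gi with dP-attained (hub i) (missed i)
  ... | u , pu , e with dist-pred (trans (sym e) gi)
  ...   | z , a , dz with vertex z
  ...     | is-leaf k x with hub-leaf⁻ a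
  ...       | refl = ≤⇒≯ (n≤1+n _) (subst (_< 2 + r) (trans (sym e) gi)
                                         (leaf-detour i (outside-copy i pu) _ x dz))
  gap-≢-3+ i r gi | u , pu , e | z , a , dz | is-hub k with missed i ≟ missed k
  ... | yes same = no-gap-step i k same (trans gi (cong suc (sym gk)))
    where
    gk≤ : gap k ≤ 2 + r
    gk≤ = ≤-trans (dP-≤ (trans pu same)) (≤-reflexive dz)
    gk≥ : 2 + r ≤ gap k
    gk≥ = ≤-pred (subst (_≤ suc (gap k)) gi (subst (λ m → gap i ≤ suc (dP (hub k) m)) same (dP-step a)))
    gk : gap k ≡ 2 + r
    gk = ≤-antisym gk≤ gk≥
  ... | no differ with meets-others k (missed i) differ
  ...   | y , py = ≤⇒≯ (≤-trans (dP-step a) (s≤s (≤-trans (dP-≤ py) (dist-edge (hub-leaf k y)))))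
                       (subst (2 <_) (sym gi) (s≤s (s≤s (s≤s z≤n))))

  positive-gaps-agree : ∀ {i k} → missed i ≡ missed k →
                        ∀ a b → gap i ≡ suc a → gap k ≡ suc b → a ≡ b
  positive-gaps-agree {i}     _ (suc (suc a)) _             gi _  = ⊥-elim (gap-≢-3+ i a gi)
  positive-gaps-agree {k = k} _ _             (suc (suc b)) _  gk = ⊥-elim (gap-≢-3+ k b gk)
  positive-gaps-agree same zero       zero       _  _  = refl
  positive-gaps-agree same (suc zero) (suc zero) _  _  = refl
  positive-gaps-agree {i} {k} same zero (suc zero) gi gk =
    ⊥-elim (no-gap-step k i (sym same) (trans gk (cong suc (sym gi))))
  positive-gaps-agree {i} {k} same (suc zero) zero gi gk =
    ⊥-elim (no-gap-step i k same (trans gi (cong suc (sym gk))))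

  code-slot : ℕ → Fin t → Fin (suc t)
  code-slot zero    _ = fromℕ t
  code-slot (suc _) m = inject₁ m

  code : Fin n₁ → Fin (suc t)
  code i = code-slot (gap i) (missed i)

  code-injective : ∀ {i k} → code i ≡ code k → i ≡ k
  code-injective {i} {k} e with gap i in gi | gap k in gk
  ... | zero  | zero  = gap-zero-unique i k gi gk
  ... | zero  | suc _ = ⊥-elim (fromℕ≢inject₁ e)
  ... | suc _ | zero  = ⊥-elim (fromℕ≢inject₁ (sym e))
  ... | suc a | suc b = same-gap-unique i k same-m
                          (trans gi (trans (cong suc (positive-gaps-agree same-m a b gi gk)) (sym gk)))
    where
    same-m : missed i ≡ missed k
    same-m = inject₁-injective e

  order-bound : n₁ ≤ suc t
  order-bound = injective⇒≤ code-injective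

+2≤double+1 : ∀ {n} → 1 ≤ n → n + 2 ≤ 2 * n + 1
+2≤double+1 {n} 1≤n = begin
  n + 2        ≤⟨ +-monoʳ-≤ n (+-monoˡ-≤ 1 1≤n) ⟩
  n + (n + 1)  ≡⟨ sym (+-assoc n n 1) ⟩
  n + n + 1    ≡⟨ cong (λ m → n + m + 1) (sym (+-identityʳ n)) ⟩
  2 * n + 1    ∎
  where open ≤-Reasoning

corollary12 : ∀ {n₁ : ℕ} (G : Graph n₁) (n₂ : ℕ) → Connected G → 2 ≤ n₂ →
  2 * n₂ + 1 < n₁ → PdAtLeast (G ⊙ K n₂) (n₂ + 2)
corollary12 G n₂ connected 2≤n₂ large t part surj res with t ≤? suc n₂
... | no many = ≤-trans (≤-reflexive (+-comm n₂ 2)) (≰⇒> many)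
... | yes few = begin
  n₂ + 2      ≤⟨ +2≤double+1 1≤n₂ ⟩
  2 * n₂ + 1  ≤⟨ ≤-pred (≤-trans large (FewParts.order-bound G connected x₀ part surj res few)) ⟩
  t           ∎
  where
  open ≤-Reasoning
  1≤n₂ : 1 ≤ n₂
  1≤n₂ = ≤-trans (s≤s z≤n) 2≤n₂
  x₀ : Fin n₂
  x₀ = fromℕ< 1≤n₂
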